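{- Let $D$ be a finite source-free bipartite digraph with bipartition $U\cup V$. If $q,\ell\ge 3$ are integers such that $\ell\le (q+3)/2$ and such that every directed cycle of $D$ has length at least $\ell$, then $D$ contains a $q$-kernel $Q$ with $|Q|\le\frac{1}{\ell}|V(D)|$ and $Q\subseteq U$.
   Context: A digraph is source-free if every vertex has in-degree at least $1$. A partition $U,V$ of $V(D)$ is a bipartition if every arc has exactly one endpoint in $U$ and one in $V$. A set of vertices is independent if there are no arcs between two of its vertices. $\mathrm{dist}(S,v)$ is the minimum over $u\in S$ of the length of a shortest directed path from $u$ to $v$. A $q$-kernel is an independent set $Q$ with $\mathrm{dist}(Q,v)\le q$ for all $v\in V(D)$. -}

module Defs where

open import Data.Nat using (ℕ; zero; suc; _≤_; _*_)
open import Data.Fin using (Fin; zero; suc; toℕ; fromℕ<)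
open import Data.Nat.DivMod using (m%n<n)
open import Data.Fin.Subset using (Subset; _∈_; _⊆_; ∣_∣)
open import Data.Bool using (Bool; true; false)
open import Data.Product using (Σ; ∃; _×_; _,_)
open import Relation.Binary.PropositionalEquality using (_≡_; _≢_)
open import Function.Definitions using (Injective)

record Digraph : Set where
  field
    n   : ℕ
    arc : Fin n → Fin n → Bool

open Digraph public

Arc : (D : Digraph) → Fin (n D) → Fin (n D) → Set
Arc D u v = arc D u v ≡ true

SourceFree : Digraph → Set
SourceFree D = ∀ v → ∃ λ u → Arc D u v

IsBipartition : (D : Digraph) → (Fin (n D) → Bool) → Set
IsBipartition D side = ∀ u v → Arc D u v → side u ≢ side v

InU : (D : Digraph) → (Fin (n D) → Bool) → Fin (n D) → Set
InU D side v = side v ≡ true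

data Walk (D : Digraph) : Fin (n D) → Fin (n D) → ℕ → Set where
  []  : ∀ {u} → Walk D u u zero
  _∷_ : ∀ {u w v k} → Arc D u w → Walk D w v k → Walk D u v (suc k)

next : ∀ {m} → Fin (suc m) → Fin (suc m)
next {m} i = fromℕ< (m%n<n (suc (toℕ i)) (suc m))

-- A directed cycle of length suc m (m + 1 ≥ 1): pairwise distinct vertices
-- c 0, …, c m with arcs c i → c ((i+1) mod (m+1)).
record Cycle (D : Digraph) (m : ℕ) : Set where
  field
    vtx  : Fin (suc m) → Fin (n D)
    inj  : Injective _≡_ _≡_ vtx
    arcs : ∀ i → Arc D (vtx i) (vtx (next i))

Independent : (D : Digraph) → Subset (n D) → Set
Independent D Q = ∀ u v → u ∈ Q → v ∈ Q → arc D u v ≡ false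

DistLe : (D : Digraph) → Subset (n D) → Fin (n D) → ℕ → Set
DistLe D Q v q = ∃ λ u → ∃ λ k → u ∈ Q × k ≤ q × Walk D u v k

IsQKernel : (D : Digraph) → ℕ → Subset (n D) → Set
IsQKernel D q Q = Independent D Q × (∀ v → DistLe D Q v q)

-- Fix an in-neighbour p v of every vertex v.  Since D is bipartite, p alternates between U and V
-- and g = p ∘ p maps U to U, so it suffices to find Q ⊆ U such that every u ∈ U reaches Q within
-- r = ℓ − 2 steps of g: then every vertex is joined from Q by a walk of length at most
-- 2r + 1 ≤ q.  Charge each u ∈ U with itself and the V-vertices v with p v = u; these charges
-- partition V(D), and each element of Q must be paid for with ℓ of them.
-- Greedily, let x be a vertex of maximal height above the cycles of g.  If that height exceeds r,
-- put y = g^r x into Q and delete everything that reaches y in at most r steps: this costs 1 and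
-- pays 2r + 1 ≥ ℓ, as the deleted part contains the path from p^(2r) x to x.  Once every height
-- is at most r, each component of g is treated in the same way after its cycle is cut open at a
-- vertex z ∈ Q, with the distance to z in place of the height.  If nothing gets deleted, the
-- cycle through z (of length at least ℓ) pays for z; otherwise the surplus r − 1 of the deleted
-- pieces does.

module Submission where

open import Defs

open import Data.Nat using (ℕ; zero; suc; _+_; _∸_; _*_; _≤_; _<_; z≤n; s≤s; _≤?_) renaming (_≟_ to _ℕ≟_)
open import Data.Nat.Properties hiding (_≟_)
open import Data.Nat.Properties using (anyUpTo?)
open import Data.Nat.GeneralisedArithmetic using (fold; fold-+)
open import Data.Nat.Induction using (<-wellFounded)
open import Data.Nat.Tactic.RingSolver using (solve-∀)
open import Induction.WellFounded using (Acc; acc)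
open import Data.Fin using (Fin; zero; suc; toℕ; _≟_)
open import Data.Nat.DivMod using (_%_; m<n⇒m%n≡m; n%n≡0)
import Data.Fin.Properties as Finₚ
open import Data.Bool using (Bool; true; false; not; _∧_; _∨_; if_then_else_)
open import Data.Bool.Properties using (∧-conicalˡ; ∧-conicalʳ; ∧-identityʳ; ∧-zeroʳ; ¬-not; not-involutive)
open import Data.Product using (∃; _×_; _,_; proj₁; proj₂)
open import Data.Sum using (_⊎_; inj₁; inj₂)
open import Data.Empty using (⊥; ⊥-elim)
open import Relation.Nullary using (¬_; Dec; yes; no; does; contradiction; _×-dec_)
open import Relation.Nullary.Decidable using (dec-true; map′)
open import Relation.Binary.PropositionalEquality
open import Relation.Binary.Definitions using (tri<; tri≈; tri>)
open import Function using (_∘_; const)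
open import Data.Vec using (tabulate)
open import Data.Vec.Properties using (lookup∘tabulate; []=⇒lookup; lookup⇒[]=)
open import Data.Fin.Subset using (Subset; _∈_; ∣_∣)

private variable
  N : ℕ
  A : Set

-- Finite sets of vertices as Boolean predicates

Pred : ℕ → Set
Pred N = Fin N → Bool

infix 4 _∈ᵖ_ _∉ᵖ_ _⊆ᵖ_
infixr 7 _∩_ _∖_
infixr 6 _∪_

_∈ᵖ_ : Fin N → Pred N → Set
w ∈ᵖ X = X w ≡ true

_∉ᵖ_ : Fin N → Pred N → Set
w ∉ᵖ X = X w ≡ false

_⊆ᵖ_ : Pred N → Pred N → Set
X ⊆ᵖ Y = ∀ w → w ∈ᵖ X → w ∈ᵖ Y

∅ : Pred N
∅ = const false

⟦_⟧ : {P : Fin N → Set} → (∀ w → Dec (P w)) → Pred N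
⟦ P? ⟧ w = does (P? w)

⁅_⁆ : Fin N → Pred N
⁅ y ⁆ = ⟦ _≟ y ⟧

_∩_ _∪_ _∖_ : Pred N → Pred N → Pred N
(X ∩ Y) w = X w ∧ Y w
(X ∪ Y) w = X w ∨ Y w
(X ∖ Y) w = X w ∧ not (Y w)

∈-or-∉ : ∀ (w : Fin N) X → w ∈ᵖ X ⊎ w ∉ᵖ X
∈-or-∉ w X with X w
... | true  = inj₁ refl
... | false = inj₂ refl

∈∉⇒⊥ : ∀ {w : Fin N} X → w ∈ᵖ X → w ∉ᵖ X → ⊥
∈∉⇒⊥ X w∈X w∉X with () ← trans (sym w∈X) w∉X

∈⟦⟧⁺ : ∀ {P : Fin N → Set} (P? : ∀ w → Dec (P w)) {w} → P w → w ∈ᵖ ⟦ P? ⟧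
∈⟦⟧⁺ P? = dec-true (P? _)

∈⟦⟧⁻ : ∀ {P : Fin N → Set} (P? : ∀ w → Dec (P w)) {w} → w ∈ᵖ ⟦ P? ⟧ → P w
∈⟦⟧⁻ P? {w} w∈ with P? w
... | yes Pw = Pw

x∈⁅x⁆ : ∀ (y : Fin N) → y ∈ᵖ ⁅ y ⁆
x∈⁅x⁆ y = ∈⟦⟧⁺ (_≟ y) refl

x∈⁅y⁆⇒x≡y : ∀ {w} (y : Fin N) → w ∈ᵖ ⁅ y ⁆ → w ≡ y
x∈⁅y⁆⇒x≡y y = ∈⟦⟧⁻ (_≟ y)

∈∩⁺ : ∀ {w : Fin N} X Y → w ∈ᵖ X → w ∈ᵖ Y → w ∈ᵖ X ∩ Y
∈∩⁺ X Y w∈X w∈Y rewrite w∈X | w∈Y = refl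

∈∩⁻ : ∀ {w : Fin N} X Y → w ∈ᵖ X ∩ Y → w ∈ᵖ X × w ∈ᵖ Y
∈∩⁻ {w = w} X Y w∈ = ∧-conicalˡ (X w) (Y w) w∈ , ∧-conicalʳ (X w) (Y w) w∈

∈∖⁺ : ∀ {w : Fin N} X Y → w ∈ᵖ X → w ∉ᵖ Y → w ∈ᵖ X ∖ Y
∈∖⁺ X Y w∈X w∉Y rewrite w∈X | w∉Y = refl

∈∖⁻ : ∀ {w : Fin N} X Y → w ∈ᵖ X ∖ Y → w ∈ᵖ X × w ∉ᵖ Y
∈∖⁻ {w = w} X Y w∈ with X w | Y w
... | true | false = refl , refl

∈∪⁺ˡ : ∀ {w : Fin N} X Y → w ∈ᵖ X → w ∈ᵖ X ∪ Y
∈∪⁺ˡ X Y w∈X rewrite w∈X = refl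

∈∪⁺ʳ : ∀ {w : Fin N} X Y → w ∈ᵖ Y → w ∈ᵖ X ∪ Y
∈∪⁺ʳ {w = w} X Y w∈Y rewrite w∈Y with X w
... | true  = refl
... | false = refl

∈∪⁻ : ∀ {w : Fin N} X Y → w ∈ᵖ X ∪ Y → w ∈ᵖ X ⊎ w ∈ᵖ Y
∈∪⁻ {w = w} X Y w∈ with X w
... | true  = inj₁ refl
... | false = inj₂ w∈

count : Pred N → ℕ
count {zero}  X = 0
count {suc N} X = (if X zero then 1 else 0) + count (X ∘ suc)

count-cong : ∀ (X Y : Pred N) → (∀ w → X w ≡ Y w) → count X ≡ count Y
count-cong {zero}  X Y X≗Y = refl
count-cong {suc N} X Y X≗Y =
  cong₂ _+_ (cong (if_then 1 else 0) (X≗Y zero)) (count-cong (X ∘ suc) (Y ∘ suc) (X≗Y ∘ suc))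

count-∅ : count {N} ∅ ≡ 0
count-∅ {zero}  = refl
count-∅ {suc N} = count-∅ {N}

count-all : ∀ (X : Pred N) → (∀ w → w ∈ᵖ X) → count X ≡ N
count-all {zero}  X all = refl
count-all {suc N} X all rewrite all zero = cong suc (count-all (X ∘ suc) (all ∘ suc))

count-⁅⁆ : ∀ (y : Fin N) → count ⁅ y ⁆ ≡ 1
count-⁅⁆ {suc N} zero    = cong suc (count-∅ {N})
count-⁅⁆ {suc N} (suc y) = count-⁅⁆ y

∣tabulate∣≡count : ∀ (X : Pred N) → ∣ tabulate X ∣ ≡ count X
∣tabulate∣≡count {zero}  X = refl
∣tabulate∣≡count {suc N} X with X zero
... | true  = cong suc (∣tabulate∣≡count (X ∘ suc))
... | false = ∣tabulate∣≡count (X ∘ suc)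

∈tabulate⁺ : ∀ (X : Pred N) {w} → w ∈ᵖ X → w ∈ tabulate X
∈tabulate⁺ X {w} w∈X = lookup⇒[]= w (tabulate X) (trans (lookup∘tabulate X w) w∈X)

∈tabulate⁻ : ∀ (X : Pred N) {w} → w ∈ tabulate X → w ∈ᵖ X
∈tabulate⁻ X {w} w∈ = trans (sym (lookup∘tabulate X w)) ([]=⇒lookup w∈)

count-split : ∀ (X Y : Pred N) → count X ≡ count (X ∩ Y) + count (X ∖ Y)
count-split {zero}  X Y = refl
count-split {suc N} X Y with X zero | Y zero
... | false | _     = count-split (X ∘ suc) (Y ∘ suc)
... | true  | true  = cong suc (count-split (X ∘ suc) (Y ∘ suc))
... | true  | false = trans (cong suc (count-split (X ∘ suc) (Y ∘ suc)))
                           (sym (+-suc (count ((X ∩ Y) ∘ suc)) _))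

count-∪ : ∀ (X Y : Pred N) → count (X ∪ Y) ≤ count X + count Y
count-∪ {zero}  X Y = z≤n
count-∪ {suc N} X Y with X zero | Y zero
... | true  | true  = s≤s (≤-trans (count-∪ (X ∘ suc) (Y ∘ suc)) (+-monoʳ-≤ _ (n≤1+n _)))
... | true  | false = s≤s (count-∪ (X ∘ suc) (Y ∘ suc))
... | false | true  = ≤-trans (s≤s (count-∪ (X ∘ suc) (Y ∘ suc))) (≤-reflexive (sym (+-suc _ _)))
... | false | false = count-∪ (X ∘ suc) (Y ∘ suc)

count-∪⁅⁆ : ∀ (X : Pred N) y → count (X ∪ ⁅ y ⁆) ≤ suc (count X)
count-∪⁅⁆ X y =
  ≤-trans (count-∪ X ⁅ y ⁆) (≤-reflexive (trans (cong (count X +_) (count-⁅⁆ y)) (+-comm _ 1)))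

count-∖⁅⁆ : ∀ (X : Pred N) {x} → x ∈ᵖ X → count X ≡ suc (count (X ∖ ⁅ x ⁆))
count-∖⁅⁆ X {x} x∈X = begin
  count X                                   ≡⟨ count-split X ⁅ x ⁆ ⟩
  count (X ∩ ⁅ x ⁆) + count (X ∖ ⁅ x ⁆)     ≡⟨ cong (_+ count (X ∖ ⁅ x ⁆)) count-X∩⁅x⁆ ⟩
  suc (count (X ∖ ⁅ x ⁆))                   ∎
  where
  open ≡-Reasoning
  X∩⁅x⁆≗⁅x⁆ : ∀ w → (X ∩ ⁅ x ⁆) w ≡ ⁅ x ⁆ w
  X∩⁅x⁆≗⁅x⁆ w with w ≟ x
  ... | yes refl = trans (∧-identityʳ (X w)) x∈X
  ... | no  _    = ∧-zeroʳ (X w)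
  count-X∩⁅x⁆ : count (X ∩ ⁅ x ⁆) ≡ 1
  count-X∩⁅x⁆ = trans (count-cong _ _ X∩⁅x⁆≗⁅x⁆) (count-⁅⁆ x)

InjectiveBelow : ℕ → (ℕ → A) → Set
InjectiveBelow k e = ∀ {i j} → i < k → j < k → e i ≡ e j → i ≡ j

injectiveBelow⇒≤count : ∀ (X : Pred N) (e : ℕ → Fin N) k → InjectiveBelow k e →
                        (∀ {i} → i < k → e i ∈ᵖ X) → k ≤ count X
injectiveBelow⇒≤count X e zero    inj e∈X = z≤n
injectiveBelow⇒≤count X e (suc k) inj e∈X = begin
  suc k                        ≤⟨ s≤s (injectiveBelow⇒≤count (X ∖ ⁅ e k ⁆) e k inj′ e∈X∖⁅ek⁆) ⟩
  suc (count (X ∖ ⁅ e k ⁆))    ≡⟨ count-∖⁅⁆ X (e∈X ≤-refl) ⟨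
  count X                      ∎
  where
  open ≤-Reasoning
  inj′ : InjectiveBelow k e
  inj′ i<k j<k = inj (m<n⇒m<1+n i<k) (m<n⇒m<1+n j<k)
  e∈X∖⁅ek⁆ : ∀ {i} → i < k → e i ∈ᵖ X ∖ ⁅ e k ⁆
  e∈X∖⁅ek⁆ {i} i<k with e i ≟ e k
  ... | yes ei≡ek = contradiction (inj (m<n⇒m<1+n i<k) ≤-refl ei≡ek) (<⇒≢ i<k)
  ... | no  _     = trans (∧-identityʳ _) (e∈X (m<n⇒m<1+n i<k))

injectiveBelow-1 : ∀ (e : ℕ → A) → InjectiveBelow 1 e
injectiveBelow-1 e {zero}  {zero}  _       _       _ = refl
injectiveBelow-1 e {suc _} {_}     (s≤s ()) _
injectiveBelow-1 e {_}     {suc _} _       (s≤s ())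

below-1 : ∀ {P : ℕ → Set} → P 0 → ∀ {i} → i < 1 → P i
below-1 P0 {zero}  _        = P0
below-1 P0 {suc _} (s≤s ())

injectiveBelow-2 : ∀ (e : ℕ → A) → e 0 ≢ e 1 → InjectiveBelow 2 e
injectiveBelow-2 e e0≢e1 {zero}        {zero}        _ _ _  = refl
injectiveBelow-2 e e0≢e1 {zero}        {suc zero}    _ _ eq = contradiction eq e0≢e1
injectiveBelow-2 e e0≢e1 {suc zero}    {zero}        _ _ eq = contradiction (sym eq) e0≢e1
injectiveBelow-2 e e0≢e1 {suc zero}    {suc zero}    _ _ _  = refl
injectiveBelow-2 e e0≢e1 {suc (suc _)} (s≤s (s≤s ())) _
injectiveBelow-2 e e0≢e1 {_} {suc (suc _)} _ (s≤s (s≤s ()))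

count-∖-< : ∀ (X Y : Pred N) {x} → x ∈ᵖ X ∩ Y → count (X ∖ Y) < count X
count-∖-< X Y x∈X∩Y = begin-strict
  count (X ∖ Y)                     <⟨ m<n+m _ (subst (1 ≤_) (sym (count-∖⁅⁆ (X ∩ Y) x∈X∩Y)) (s≤s z≤n)) ⟩
  count (X ∩ Y) + count (X ∖ Y)     ≡⟨ count-split X Y ⟨
  count X                           ∎
  where open ≤-Reasoning

empty-or-argmax : ∀ (X : Pred N) (ρ : Fin N → ℕ) →
  (∀ w → w ∉ᵖ X) ⊎ ∃ λ x → x ∈ᵖ X × (∀ w → w ∈ᵖ X → ρ w ≤ ρ x)
empty-or-argmax {zero}  X ρ = inj₁ λ ()
empty-or-argmax {suc N} X ρ with empty-or-argmax (X ∘ suc) (ρ ∘ suc) | ∈-or-∉ zero X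
... | inj₁ empty | inj₂ 0∉X = inj₁ λ { zero → 0∉X ; (suc w) → empty w }
... | inj₁ empty | inj₁ 0∈X = inj₂ (zero , 0∈X , λ
      { zero _ → ≤-refl ; (suc w) w∈X → ⊥-elim (∈∉⇒⊥ X w∈X (empty w)) })
... | inj₂ (x , x∈X , max) | inj₂ 0∉X = inj₂ (suc x , x∈X , λ
      { zero 0∈X → ⊥-elim (∈∉⇒⊥ X 0∈X 0∉X) ; (suc w) w∈X → max w w∈X })
... | inj₂ (x , x∈X , max) | inj₁ 0∈X with ρ zero ≤? ρ (suc x)
...   | yes ρ0≤ = inj₂ (suc x , x∈X , λ { zero _ → ρ0≤ ; (suc w) w∈X → max w w∈X })
...   | no  ρ0≰ = inj₂ (zero , 0∈X , λ
        { zero _ → ≤-refl ; (suc w) w∈X → ≤-trans (max w w∈X) (<⇒≤ (≰⇒> ρ0≰)) })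

empty-or-element : ∀ (X : Pred N) → (∀ w → w ∉ᵖ X) ⊎ ∃ (_∈ᵖ X)
empty-or-element X with empty-or-argmax X (const 0)
... | inj₁ empty          = inj₁ empty
... | inj₂ (x , x∈X , _) = inj₂ (x , x∈X)

Least : (ℕ → Set) → ℕ → Set
Least P i = P i × (∀ j → j < i → ¬ P j)

Least-unique : ∀ {P i j} → Least P i → Least P j → i ≡ j
Least-unique {i = i} {j} (Pi , i-min) (Pj , j-min) with <-cmp i j
... | tri< i<j _ _ = contradiction Pi (j-min i i<j)
... | tri≈ _ i≡j _ = i≡j
... | tri> _ _ j<i = contradiction Pj (i-min j j<i)

∃≤? : ∀ {P : ℕ → Set} → (∀ i → Dec (P i)) → ∀ N → Dec (∃ λ i → i ≤ N × P i)
∃≤? P? N = map′ (λ (i , i<1+N , Pi) → i , ≤-pred i<1+N , Pi) (λ (i , i≤N , Pi) → i , s≤s i≤N , Pi)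
                (anyUpTo? P? (suc N))

module _ {P : ℕ → Set} (P? : ∀ i → Dec (P i)) where

  least-upTo : ∀ N → (∃ λ i → i ≤ N × Least P i) ⊎ (∀ i → i ≤ N → ¬ P i)
  least-upTo zero with P? 0
  ... | yes P0 = inj₁ (0 , z≤n , P0 , λ _ ())
  ... | no ¬P0 = inj₂ λ { zero _ → ¬P0 }
  least-upTo (suc N) with least-upTo N
  ... | inj₁ (i , i≤N , least) = inj₁ (i , m≤n⇒m≤1+n i≤N , least)
  ... | inj₂ none with P? (suc N)
  ...   | yes PN = inj₁ (suc N , ≤-refl , PN , λ j j≤N → none j (≤-pred j≤N))
  ...   | no ¬PN = inj₂ λ i i≤1+N → case (m≤n⇒m<n∨m≡n i≤1+N)
    where
    case : ∀ {i} → i < suc N ⊎ i ≡ suc N → ¬ P i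
    case (inj₁ i<1+N) = none _ (≤-pred i<1+N)
    case (inj₂ refl)  = ¬PN

  least : ∀ k → P k → ∃ λ i → i ≤ k × Least P i
  least k Pk with least-upTo k
  ... | inj₁ found = found
  ... | inj₂ none  = contradiction Pk (none k ≤-refl)

  -- The least i ≤ N with P i, and 0 when there is none.
  μ : ℕ → ℕ
  μ N with least-upTo N
  ... | inj₁ (i , _) = i
  ... | inj₂ _       = 0

  μ-least : ∀ {N k} → k ≤ N → P k → Least P (μ N)
  μ-least {N} {k} k≤N Pk with least-upTo N
  ... | inj₁ (_ , _ , least) = least
  ... | inj₂ none            = contradiction Pk (none k k≤N)

infix 9 _^[_]_

_^[_]_ : (A → A) → ℕ → A → A
f ^[ k ] x = fold x f k

module _ (f : A → A) where

  ^-+ : ∀ i j x → f ^[ i + j ] x ≡ f ^[ i ] (f ^[ j ] x)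
  ^-+ i j x = fold-+ x f i

  ^-comm : ∀ k x → f ^[ k ] (f x) ≡ f (f ^[ k ] x)
  ^-comm zero    x = refl
  ^-comm (suc k) x = cong f (^-comm k x)

  hit-noRepeat : ∀ {x z i a b} → f ^[ i ] x ≡ z → (∀ j → j < i → f ^[ j ] x ≢ z) →
                 a < b → b ≤ i → f ^[ a ] x ≢ f ^[ b ] x
  hit-noRepeat {x} {z} {i} {a} {b} hit early a<b b≤i eq = early (i ∸ b + a) earlier rehit
    where
    earlier : i ∸ b + a < i
    earlier = ≤-trans (+-monoʳ-< (i ∸ b) a<b) (≤-reflexive (m∸n+n≡m b≤i))
    rehit : f ^[ i ∸ b + a ] x ≡ z
    rehit = begin
      f ^[ i ∸ b + a ] x          ≡⟨ ^-+ (i ∸ b) a x ⟩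
      f ^[ i ∸ b ] (f ^[ a ] x)   ≡⟨ cong (f ^[ i ∸ b ]_) eq ⟩
      f ^[ i ∸ b ] (f ^[ b ] x)   ≡⟨ ^-+ (i ∸ b) b x ⟨
      f ^[ i ∸ b + b ] x          ≡⟨ cong (λ k → f ^[ k ] x) (m∸n+n≡m b≤i) ⟩
      f ^[ i ] x                  ≡⟨ hit ⟩
      z                           ∎
      where open ≡-Reasoning

  firstHit-injective : ∀ {x z i} → f ^[ i ] x ≡ z → (∀ j → j < i → f ^[ j ] x ≢ z) →
                       InjectiveBelow (suc i) (λ j → f ^[ j ] x)
  firstHit-injective hit early {a} {b} a≤i b≤i eq with <-cmp a b
  ... | tri< a<b _ _ = ⊥-elim (hit-noRepeat hit early a<b (≤-pred b≤i) eq)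
  ... | tri≈ _ a≡b _ = a≡b
  ... | tri> _ _ b<a = ⊥-elim (hit-noRepeat hit early b<a (≤-pred a≤i) (sym eq))

module _ (f : Fin N → Fin N) where

  hit-within : ∀ {x z i} → f ^[ i ] x ≡ z → ∃ λ j → j < N × f ^[ j ] x ≡ z
  hit-within {x = x} {z} {i} hit with least (λ j → f ^[ j ] x ≟ z) i hit
  ... | j , _ , hitʲ , early = j , Finₚ.injective⇒≤ orbit-injective , hitʲ
    where
    orbit-injective : ∀ {a b : Fin (suc j)} → f ^[ toℕ a ] x ≡ f ^[ toℕ b ] x → a ≡ b
    orbit-injective {a} {b} eq = Finₚ.toℕ-injective
      (firstHit-injective f hitʲ early (Finₚ.toℕ<n a) (Finₚ.toℕ<n b) eq)

  orbit-repeats : ∀ x → ∃ λ a → ∃ λ b → a < b × b ≤ N × f ^[ a ] x ≡ f ^[ b ] x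
  orbit-repeats x with Finₚ.pigeonhole (n<1+n N) (λ (k : Fin (suc N)) → f ^[ toℕ k ] x)
  ... | a , b , a<b , eq = toℕ a , toℕ b , a<b , Finₚ.toℕ≤pred[n] b , eq

kernel-arith-tree : ∀ r s → 1 ≤ r → (2 + r) * suc (suc s) ≤ 3 + (suc (r + r) + 0) * suc s
kernel-arith-tree (suc r) s _ = ≤-trans (m≤m+n _ (r * s)) (≤-reflexive (sym (identity r s)))
  where
  identity : ∀ r s → 3 + (suc (suc r + suc r) + 0) * suc s ≡ (2 + suc r) * suc (suc s) + r * s
  identity = solve-∀

kernel-arith-cyclic : ∀ r s → (2 + r) * suc (suc s) ≤ 2 + (suc (r + r) + 1) * suc s
kernel-arith-cyclic r s = ≤-trans (m≤m+n _ (r * s)) (≤-reflexive (sym (identity r s)))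
  where
  identity : ∀ r s → 2 + (suc (r + r) + 1) * suc s ≡ (2 + r) * suc (suc s) + r * s
  identity = solve-∀

-- p is an in-neighbour map of the digraph (p w → w is an arc) and isU w says w ∈ U.

module Alternating (n : ℕ) (p : Fin n → Fin n) (isU : Pred n)
                   (alt : ∀ w → isU (p w) ≡ not (isU w)) where

  g : Fin n → Fin n
  g w = p (p w)

  g^≡p^ : ∀ i w → g ^[ i ] w ≡ p ^[ i + i ] w
  g^≡p^ zero    w = refl
  g^≡p^ (suc i) w = trans (cong g (g^≡p^ i w)) (cong (λ k → p ^[ suc k ] w) (sym (+-suc i i)))

  isU-g : ∀ w → isU (g w) ≡ isU w
  isU-g w = trans (alt (p w)) (trans (cong not (alt w)) (not-involutive (isU w)))

  isU-g^ : ∀ i w → isU (g ^[ i ] w) ≡ isU w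
  isU-g^ zero    w = refl
  isU-g^ (suc i) w = trans (isU-g (g ^[ i ] w)) (isU-g^ i w)

  p-of-U : ∀ {w} → w ∈ᵖ isU → p w ∉ᵖ isU
  p-of-U {w} w∈U = trans (alt w) (cong not w∈U)

  Reaches : Fin n → Fin n → Set
  Reaches w z = ∃ λ i → i < n × g ^[ i ] w ≡ z

  reaches : ∀ {w z} i → g ^[ i ] w ≡ z → Reaches w z
  reaches i hit = hit-within g {i = i} hit

  reaches? : ∀ w z → Dec (Reaches w z)
  reaches? w z = anyUpTo? (λ i → g ^[ i ] w ≟ z) n

  Cyclic : Fin n → Set
  Cyclic w = Reaches (g w) w

  cyclic? : ∀ w → Dec (Cyclic w)
  cyclic? w = reaches? (g w) w

  reaches-g : ∀ {w z} → Cyclic z → Reaches w z → Reaches (g w) z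
  reaches-g z-cyc (zero , _ , refl) = z-cyc
  reaches-g {w} _ (suc i , _ , hit) = reaches i (trans (^-comm g i w) hit)

  eventually-cyclic : ∀ w → ∃ λ a → a ≤ n × Cyclic (g ^[ a ] w)
  eventually-cyclic w with orbit-repeats g w
  ... | a , b , a<b , b≤n , eq = a , ≤-trans (<⇒≤ a<b) b≤n , reaches (b ∸ suc a) (begin
    g ^[ b ∸ suc a ] (g (g ^[ a ] w))  ≡⟨ ^-+ g (b ∸ suc a) (suc a) w ⟨
    g ^[ b ∸ suc a + suc a ] w         ≡⟨ cong (λ k → g ^[ k ] w) (m∸n+n≡m a<b) ⟩
    g ^[ b ] w                         ≡⟨ eq ⟨
    g ^[ a ] w                         ∎)
    where open ≡-Reasoning

  cyclic-g : ∀ {z} → Cyclic z → Cyclic (g z)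
  cyclic-g {z} (k , _ , back) = reaches k (trans (^-comm g k (g z)) (cong g back))

  cyclic-V-pred : ∀ {w} → Cyclic w → w ∈ᵖ isU → ∃ λ v → v ∉ᵖ isU × p v ≡ w
  cyclic-V-pred {w} (k , _ , back) w∈U =
    p (g ^[ k ] w) , p-of-U (trans (isU-g^ k w) w∈U) , trans (sym (^-comm g k w)) back

  cyclic⇒p-return : ∀ {z} → Cyclic z → ∃ λ k → p ^[ k ] (p z) ≡ z
  cyclic⇒p-return {z} (k , _ , back) = k + suc k , (begin
    p ^[ k + suc k ] (p z)   ≡⟨ ^-comm p (k + suc k) z ⟩
    p ^[ suc k + suc k ] z   ≡⟨ g^≡p^ (suc k) z ⟨
    g (g ^[ k ] z)           ≡⟨ ^-comm g k z ⟨
    g ^[ k ] (g z)           ≡⟨ back ⟩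
    z                        ∎)
    where open ≡-Reasoning

  RankClosed : Pred n → (Fin n → ℕ) → Set
  RankClosed X ρ = ∀ w → w ∈ᵖ X → 1 ≤ ρ w → g w ∈ᵖ X × suc (ρ (g w)) ≡ ρ w

  rankClosed-g^ : ∀ {X ρ w} → RankClosed X ρ → w ∈ᵖ X →
                  ∀ j → j ≤ ρ w → g ^[ j ] w ∈ᵖ X × ρ (g ^[ j ] w) + j ≡ ρ w
  rankClosed-g^ {ρ = ρ} {w} closed w∈X zero    _      = w∈X , +-identityʳ (ρ w)
  rankClosed-g^ {ρ = ρ} {w} closed w∈X (suc j) 1+j≤ρw =
    let (u∈X , ρu+j≡ρw) = rankClosed-g^ closed w∈X j (<⇒≤ 1+j≤ρw)
        (gu∈X , step)   = closed _ u∈X (1≤ρu ρu+j≡ρw)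
    in gu∈X , trans (+-suc _ j) (trans (cong (_+ j) step) ρu+j≡ρw)
    where
    1≤ρu : ∀ {a} → a + j ≡ ρ w → 1 ≤ a
    1≤ρu {zero}  refl = contradiction 1+j≤ρw (n≮n j)
    1≤ρu {suc _} _    = s≤s z≤n

  -- The number of g-steps until a vertex first satisfies P (0 if this takes more than n steps).
  module HittingTime (P : Fin n → Set) (P? : ∀ w → Dec (P w)) where

    Hits : Fin n → ℕ → Set
    Hits w i = P (g ^[ i ] w)

    abstract
      time : Fin n → ℕ
      time w = μ (λ i → P? (g ^[ i ] w)) n

      time-least : ∀ {w i} → i ≤ n → Hits w i → Least (Hits w) (time w)
      time-least {w} = μ-least (λ i → P? (g ^[ i ] w))

    time≡ : ∀ {w i j} → i ≤ n → Hits w i → Least (Hits w) j → time w ≡ j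
    time≡ i≤n hit = Least-unique (time-least i≤n hit)

    time-zero : ∀ {w} → P w → time w ≡ 0
    time-zero Pw = time≡ z≤n Pw (Pw , λ _ ())

    time-zero⁻ : ∀ {w i} → i ≤ n → Hits w i → time w ≡ 0 → P w
    time-zero⁻ i≤n hit t≡0 = subst (Hits _) t≡0 (proj₁ (time-least i≤n hit))

    time-step : ∀ {w i} → i ≤ n → Hits w i → 1 ≤ time w → suc (time (g w)) ≡ time w
    time-step {w} {i} i≤n hit 1≤t with time w | time-least i≤n hit
    ... | suc t | hitᵗ , early = cong suc (time≡ t≤n hit′ (hit′ , early′))
      where
      hit′ : Hits (g w) t
      hit′ = subst P (sym (^-comm g t w)) hitᵗ
      early′ : ∀ j → j < t → ¬ Hits (g w) j
      early′ j j<t = early (suc j) (s≤s j<t) ∘ subst P (^-comm g j w)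
      t≤n : t ≤ n
      t≤n = ≤-trans (n≤1+n t) (≤-trans (≮⇒≥ λ i<1+t → early i i<1+t hit) i≤n)

    time-rankClosed : ∀ X → (∀ w → w ∈ᵖ X → ∃ λ i → i ≤ n × Hits w i) →
                      (∀ w → w ∈ᵖ X → 1 ≤ time w → g w ∈ᵖ X) → RankClosed X time
    time-rankClosed X hits closed w w∈X 1≤t with hits w w∈X
    ... | i , i≤n , hit = closed w w∈X 1≤t , time-step i≤n hit 1≤t

  module Height = HittingTime Cyclic cyclic?

  height : Fin n → ℕ
  height = Height.time

  height-rankClosed : ∀ X → (∀ w → w ∈ᵖ X → g w ∈ᵖ X) → RankClosed X height
  height-rankClosed X closed =
    Height.time-rankClosed X (λ w _ → eventually-cyclic w) (λ w w∈X _ → closed w w∈X)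

  cyclic⇒height≡0 : ∀ {w} → Cyclic w → height w ≡ 0
  cyclic⇒height≡0 = Height.time-zero

  height≡0⇒cyclic : ∀ {w} → height w ≡ 0 → Cyclic w
  height≡0⇒cyclic {w} with eventually-cyclic w
  ... | _ , a≤n , hit = Height.time-zero⁻ a≤n hit

  height-g : ∀ {w} → 1 ≤ height w → suc (height (g w)) ≡ height w
  height-g {w} with eventually-cyclic w
  ... | _ , a≤n , hit = Height.time-step a≤n hit

  height-g^ : ∀ k x → 1 ≤ height (g ^[ k ] x) → height (g ^[ k ] x) + k ≡ height x
  height-g^ zero    x _     = +-identityʳ (height x)
  height-g^ (suc k) x 1≤h = begin
    height (g u) + suc k     ≡⟨ +-suc (height (g u)) k ⟩
    suc (height (g u)) + k   ≡⟨ cong (_+ k) (height-g 1≤hu) ⟩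
    height u + k             ≡⟨ height-g^ k x 1≤hu ⟩
    height x                 ∎
    where
    open ≡-Reasoning
    u = g ^[ k ] x
    1≤hu : 1 ≤ height u
    1≤hu with height u in hu≡0
    ... | suc _ = s≤s z≤n
    ... | zero  = contradiction (cyclic⇒height≡0 (cyclic-g (height≡0⇒cyclic hu≡0)))
                                (λ h≡0 → <⇒≢ 1≤h (sym h≡0))

  tree-bottom : ∀ {X} → (∀ w → w ∈ᵖ X → g w ∈ᵖ X) → ∀ {w} → w ∈ᵖ X → ¬ Cyclic w →
                ∃ λ w₁ → w₁ ∈ᵖ X × height w₁ ≡ 1 × Cyclic (g w₁)
  tree-bottom {X} closed {w} w∈X w-acyc with height w in hw≡
  ... | zero  = contradiction (height≡0⇒cyclic hw≡) w-acyc
  ... | suc t with rankClosed-g^ (height-rankClosed X closed) w∈X t (subst (t ≤_) (sym hw≡) (n≤1+n t))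
  ...   | w₁∈X , hw₁+t≡hw = g ^[ t ] w , w₁∈X , hw₁≡1 ,
          height≡0⇒cyclic (suc-injective (trans (height-g (≤-reflexive (sym hw₁≡1))) hw₁≡1))
    where
    hw₁≡1 : height (g ^[ t ] w) ≡ 1
    hw₁≡1 = +-cancelʳ-≡ t _ 1 (trans hw₁+t≡hw hw≡)

  -- For X ⊆ U, X ⁺ is X together with the V-vertices whose in-neighbour p lies in X.
  infix 10 _⁺
  _⁺ : Pred n → Pred n
  (X ⁺) w = if isU w then X w else X (p w)

  weight : Pred n → ℕ
  weight X = count (X ⁺)

  weight-split : ∀ X Y → weight X ≡ weight (X ∩ Y) + weight (X ∖ Y)
  weight-split X Y = trans (count-split (X ⁺) (Y ⁺)) (cong₂ _+_ (count-cong _ _ ∩⁺) (count-cong _ _ ∖⁺))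
    where
    ∩⁺ : ∀ w → (X ⁺ ∩ Y ⁺) w ≡ ((X ∩ Y) ⁺) w
    ∩⁺ w with isU w
    ... | true  = refl
    ... | false = refl
    ∖⁺ : ∀ w → (X ⁺ ∖ Y ⁺) w ≡ ((X ∖ Y) ⁺) w
    ∖⁺ w with isU w
    ... | true  = refl
    ... | false = refl

  weight-∩-⊆ : ∀ X Y → Y ⊆ᵖ X → weight (X ∩ Y) ≡ weight Y
  weight-∩-⊆ X Y Y⊆X = count-cong _ _ λ w → (cong₂ (if isU w then_else_) (∩≗ w) (∩≗ (p w)))
    where
    ∩≗ : ∀ w → (X ∩ Y) w ≡ Y w
    ∩≗ w with Y w in w∈?
    ... | true  = trans (∧-identityʳ (X w)) (Y⊆X w w∈?)
    ... | false = ∧-zeroʳ (X w)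

  weight-isU : weight isU ≡ n
  weight-isU = count-all (isU ⁺) all
    where
    all : ∀ w → w ∈ᵖ isU ⁺
    all w with isU w in w∈?
    ... | true  = refl
    ... | false = trans (alt w) (cong not w∈?)

  U∈⁺ : ∀ {X w} → w ∈ᵖ isU → w ∈ᵖ X → w ∈ᵖ X ⁺
  U∈⁺ {X} {w} w∈U w∈X rewrite w∈U = w∈X

  V∈⁺ : ∀ {X w} → w ∉ᵖ isU → p w ∈ᵖ X → w ∈ᵖ X ⁺
  V∈⁺ {X} {w} w∉U pw∈X rewrite w∉U = pw∈X

  ⁺-p-closed : ∀ {X} → X ⊆ᵖ isU → (∀ w → w ∈ᵖ X → g w ∈ᵖ X) → ∀ w → w ∈ᵖ X ⁺ → p w ∈ᵖ X ⁺
  ⁺-p-closed {X} X⊆U g-closed w w∈X⁺ with isU w in w∈?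
  ... | true  rewrite p-of-U w∈? = g-closed w w∈X⁺
  ... | false rewrite trans (alt w) (cong not w∈?) = w∈X⁺

  weight-lower : ∀ X a b (u v : ℕ → Fin n) →
                 InjectiveBelow a u → (∀ {i} → i < a → u i ∈ᵖ X × u i ∈ᵖ isU) →
                 InjectiveBelow b (p ∘ v) → (∀ {j} → j < b → v j ∉ᵖ isU × p (v j) ∈ᵖ X) →
                 a + b ≤ weight X
  weight-lower X a b u v u-inj u∈ v-inj v∈ = begin
    a + b                                         ≤⟨ +-mono-≤ U-part V-part ⟩
    count (X ⁺ ∩ isU) + count (X ⁺ ∖ isU)         ≡⟨ count-split (X ⁺) isU ⟨
    weight X                                      ∎
    where
    open ≤-Reasoning
    U-part : a ≤ count (X ⁺ ∩ isU)
    U-part = injectiveBelow⇒≤count _ u a u-inj λ i<a → let (ui∈X , ui∈U) = u∈ i<a in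
      ∈∩⁺ (X ⁺) isU (U∈⁺ {X} ui∈U ui∈X) ui∈U
    V-part : b ≤ count (X ⁺ ∖ isU)
    V-part = injectiveBelow⇒≤count _ v b (λ i<b j<b eq → v-inj i<b j<b (cong p eq)) λ j<b →
      let (vj∉U , pvj∈X) = v∈ j<b in
      ∈∖⁺ (X ⁺) isU (V∈⁺ {X} vj∉U pvj∈X) vj∉U

  module Pruning (r : ℕ) where

    Covers : Pred n → Fin n → Set
    Covers Q w = ∃ λ i → i ≤ r × g ^[ i ] w ∈ᵖ Q

    pieceWeight : ℕ → ℕ
    pieceWeight e = suc (r + r) + e

    -- Every pruned piece contains a g-path of r steps, worth 2r+1 to the weight, and
    -- one more when the start of the path has a V-neighbour p v.
    data Bonus (B : Pred n) : ℕ → Set where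
      no-bonus : Bonus B 0
      V-preds  : (∀ w → w ∈ᵖ B → ∃ λ v → v ∉ᵖ isU × p v ≡ w) → Bonus B 1

    bonus-⊆ : ∀ {B B′ e} → B′ ⊆ᵖ B → Bonus B e → Bonus B′ e
    bonus-⊆ B′⊆B no-bonus     = no-bonus
    bonus-⊆ B′⊆B (V-preds vp) = V-preds λ w w∈B′ → vp w (B′⊆B w w∈B′)

    -- rest is what is left of B after cutting off pieces as in Piece below; kernel holds their tops.
    record Pruned (B : Pred n) (ρ : Fin n → ℕ) (e : ℕ) : Set where
      field
        rest kernel    : Pred n
        rest⊆B         : rest ⊆ᵖ B
        rest-low       : ∀ w → w ∈ᵖ rest → ρ w ≤ r
        rest-closed    : RankClosed rest ρ
        kernel⊆B       : kernel ⊆ᵖ B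
        kernel-covers  : ∀ w → w ∈ᵖ B → w ∉ᵖ rest → Covers kernel w
        rank0-kept     : ∀ w → w ∈ᵖ B → ρ w ≡ 0 → w ∈ᵖ rest
        rank1-removed  : ∀ w → w ∈ᵖ B → w ∉ᵖ rest → ρ w ≡ 1 → ∃ λ x → x ∈ᵖ B × g ^[ r ] x ≡ w
        weight-bound   : weight rest + pieceWeight e * count kernel ≤ weight B

    nothing-pruned : ∀ {B ρ e} → (∀ w → w ∈ᵖ B → ρ w ≤ r) → RankClosed B ρ → Pruned B ρ e
    nothing-pruned {B} {ρ} {e} low closed = record
      { rest = B ; kernel = ∅ ; rest⊆B = λ _ w∈B → w∈B ; rest-low = low ; rest-closed = closed
      ; kernel⊆B = λ _ ()
      ; kernel-covers = λ _ w∈B w∉B → ⊥-elim (∈∉⇒⊥ B w∈B w∉B)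
      ; rank0-kept = λ _ w∈B _ → w∈B
      ; rank1-removed = λ _ w∈B w∉B _ → ⊥-elim (∈∉⇒⊥ B w∈B w∉B)
      ; weight-bound = ≤-reflexive (begin
          weight B + pieceWeight e * count {n} ∅   ≡⟨ cong (λ c → weight B + pieceWeight e * c) (count-∅ {n}) ⟩
          weight B + pieceWeight e * 0             ≡⟨ cong (weight B +_) (*-zeroʳ (pieceWeight e)) ⟩
          weight B + 0                             ≡⟨ +-identityʳ _ ⟩
          weight B                                 ∎) }
      where open ≡-Reasoning

    -- Cut off the piece hanging below y = g^[r] x, where x ∈ B has maximal rank ρ x > r.
    module Piece {B ρ} (closed : RankClosed B ρ) (B⊆U : B ⊆ᵖ isU)
                 {x} (x∈B : x ∈ᵖ B) (max : ∀ w → w ∈ᵖ B → ρ w ≤ ρ x) (r<ρx : r < ρ x) where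

      path : ∀ i → i ≤ r → g ^[ i ] x ∈ᵖ B × ρ (g ^[ i ] x) + i ≡ ρ x
      path i i≤r = rankClosed-g^ closed x∈B i (≤-trans i≤r (<⇒≤ r<ρx))

      y : Fin n
      y = g ^[ r ] x

      y∈B : y ∈ᵖ B
      y∈B = proj₁ (path r ≤-refl)

      ρy+r≡ρx : ρ y + r ≡ ρ x
      ρy+r≡ρx = proj₂ (path r ≤-refl)

      1≤ρy : 1 ≤ ρ y
      1≤ρy with ρ y in ρy≡
      ... | suc _ = s≤s z≤n
      ... | zero  = contradiction (trans (sym ρy+r≡ρx) (cong (_+ r) ρy≡)) (<⇒≢ r<ρx ∘ sym)

      Below : Fin n → Set
      Below w = ∃ λ j → j ≤ r × g ^[ j ] w ≡ y × ρ w ≡ ρ y + j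

      below? : ∀ w → Dec (Below w)
      below? w = ∃≤? (λ j → (g ^[ j ] w ≟ y) ×-dec (ρ w ℕ≟ ρ y + j)) r

      T : Pred n
      T = ⟦ below? ⟧

      B′ : Pred n
      B′ = B ∖ T

      B′⊆B : B′ ⊆ᵖ B
      B′⊆B w w∈B′ = proj₁ (∈∖⁻ B T w∈B′)

      path∈T : ∀ i → i ≤ r → g ^[ i ] x ∈ᵖ B ∩ T
      path∈T i i≤r = ∈∩⁺ B T (proj₁ (path i i≤r)) (∈⟦⟧⁺ below? (r ∸ i , m∸n≤m r i , reach-y , rank))
        where
        reach-y : g ^[ r ∸ i ] (g ^[ i ] x) ≡ y
        reach-y = trans (sym (^-+ g (r ∸ i) i x)) (cong (λ k → g ^[ k ] x) (m∸n+n≡m i≤r))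
        rank : ρ (g ^[ i ] x) ≡ ρ y + (r ∸ i)
        rank = +-cancelʳ-≡ i _ _ (begin
          ρ (g ^[ i ] x) + i      ≡⟨ proj₂ (path i i≤r) ⟩
          ρ x                     ≡⟨ ρy+r≡ρx ⟨
          ρ y + r                 ≡⟨ cong (ρ y +_) (m∸n+n≡m i≤r) ⟨
          ρ y + (r ∸ i + i)       ≡⟨ +-assoc (ρ y) (r ∸ i) i ⟨
          ρ y + (r ∸ i) + i       ∎)
          where open ≡-Reasoning

      path-injective : InjectiveBelow (suc r) (λ i → g ^[ i ] x)
      path-injective {i} {j} i≤r j≤r eq = +-cancelˡ-≡ (ρ (g ^[ i ] x)) i j (begin
        ρ (g ^[ i ] x) + i   ≡⟨ proj₂ (path i (≤-pred i≤r)) ⟩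
        ρ x                  ≡⟨ proj₂ (path j (≤-pred j≤r)) ⟨
        ρ (g ^[ j ] x) + j   ≡⟨ cong (λ u → ρ u + j) eq ⟨
        ρ (g ^[ i ] x) + j   ∎)
        where open ≡-Reasoning

      smaller : count B′ < count B
      smaller = count-∖-< B T (path∈T 0 z≤n)

      B′-closed : RankClosed B′ ρ
      B′-closed w w∈B′ 1≤ρw with ∈∖⁻ B T w∈B′
      ... | w∈B , w∉T with closed w w∈B 1≤ρw
      ...   | gw∈B , step = ∈∖⁺ B T gw∈B gw∉T , step
        where
        gw∉T : g w ∉ᵖ T
        gw∉T with ∈-or-∉ (g w) T
        ... | inj₂ gw∉T = gw∉T
        ... | inj₁ gw∈T with ∈⟦⟧⁻ below? gw∈T
        ...   | j , j≤r , gʲgw≡y , ρgw≡ with m≤n⇒m<n∨m≡n j≤r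
        ...     | inj₁ j<r = ⊥-elim (∈∉⇒⊥ T (∈⟦⟧⁺ below? (suc j , j<r , trans (sym (^-comm g j w)) gʲgw≡y ,
                                      trans (sym step) (trans (cong suc ρgw≡) (sym (+-suc (ρ y) j))))) w∉T)
        ...     | inj₂ refl = contradiction (max w w∈B) (<⇒≱ (begin-strict
            ρ x               ≡⟨ ρy+r≡ρx ⟨
            ρ y + r           ≡⟨ ρgw≡ ⟨
            ρ (g w)           <⟨ n<1+n _ ⟩
            suc (ρ (g w))     ≡⟨ step ⟩
            ρ w               ∎))
          where open ≤-Reasoning

      path-U : ∀ {i} → i < suc r → g ^[ i ] x ∈ᵖ B ∩ T × g ^[ i ] x ∈ᵖ isU
      path-U i≤r = path∈T _ (≤-pred i≤r) , B⊆U _ (proj₁ (path _ (≤-pred i≤r)))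

      p-path-∉U : ∀ {j} → j ≤ r → p (g ^[ j ] x) ∉ᵖ isU
      p-path-∉U j≤r = p-of-U (B⊆U _ (proj₁ (path _ j≤r)))

      piece-weight : ∀ {e} → Bonus B e → pieceWeight e ≤ weight (B ∩ T)
      piece-weight no-bonus = begin
        suc (r + r) + 0   ≡⟨ +-identityʳ _ ⟩
        suc r + r         ≤⟨ weight-lower (B ∩ T) (suc r) r (λ i → g ^[ i ] x) (λ j → p (g ^[ j ] x))
                               path-injective path-U V-injective V-path ⟩
        weight (B ∩ T)    ∎
        where
        open ≤-Reasoning
        V-injective : InjectiveBelow r (λ j → g ^[ suc j ] x)
        V-injective i<r j<r eq = suc-injective (path-injective (s≤s i<r) (s≤s j<r) eq)
        V-path : ∀ {j} → j < r → p (g ^[ j ] x) ∉ᵖ isU × g ^[ suc j ] x ∈ᵖ B ∩ T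
        V-path j<r = p-path-∉U (<⇒≤ j<r) , path∈T _ j<r
      piece-weight (V-preds vp) with vp x x∈B
      ... | v , v∉U , pv≡x = begin
        suc (r + r) + 1   ≡⟨ +-comm (suc (r + r)) 1 ⟩
        suc (suc (r + r)) ≡⟨ cong suc (+-suc r r) ⟨
        suc r + suc r     ≤⟨ weight-lower (B ∩ T) (suc r) (suc r) (λ i → g ^[ i ] x) V
                               path-injective path-U V-injective V-path ⟩
        weight (B ∩ T)    ∎
        where
        open ≤-Reasoning
        V : ℕ → Fin n
        V zero    = v
        V (suc j) = p (g ^[ j ] x)
        p∘V : ∀ j → p (V j) ≡ g ^[ j ] x
        p∘V zero    = pv≡x
        p∘V (suc j) = refl
        V-injective : InjectiveBelow (suc r) (p ∘ V)
        V-injective {i} {j} i≤r j≤r eq = path-injective i≤r j≤r (trans (sym (p∘V i)) (trans eq (p∘V j)))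
        V-path : ∀ {j} → j < suc r → V j ∉ᵖ isU × p (V j) ∈ᵖ B ∩ T
        V-path {zero}  _     = v∉U , subst (_∈ᵖ B ∩ T) (sym pv≡x) (path∈T 0 z≤n)
        V-path {suc j} j<r = p-path-∉U (<⇒≤ (≤-pred j<r)) , path∈T (suc j) (≤-pred j<r)

      T⇒1≤ρ : ∀ {w} → w ∈ᵖ T → 1 ≤ ρ w
      T⇒1≤ρ w∈T = let (j , _ , _ , ρw≡) = ∈⟦⟧⁻ below? w∈T in
        ≤-trans 1≤ρy (≤-trans (m≤m+n (ρ y) j) (≤-reflexive (sym ρw≡)))

      T⇒covered : ∀ {w} → w ∈ᵖ T → Covers ⁅ y ⁆ w
      T⇒covered w∈T = let (j , j≤r , gʲw≡y , _) = ∈⟦⟧⁻ below? w∈T in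
        j , j≤r , subst (_∈ᵖ ⁅ y ⁆) (sym gʲw≡y) (x∈⁅x⁆ y)

      T∩ρ≡1⇒y : ∀ {w} → w ∈ᵖ T → ρ w ≡ 1 → w ≡ y
      T∩ρ≡1⇒y w∈T ρw≡1 with ∈⟦⟧⁻ below? w∈T
      ... | zero  , _ , w≡y , _ = w≡y
      ... | suc j , _ , _ , ρw≡ =
        contradiction (trans (sym ρw≡) ρw≡1) (>⇒≢ (+-mono-≤ {1} {ρ y} {1} {suc j} 1≤ρy (s≤s z≤n)))

      weight-extend : ∀ {e} → Bonus B e → ∀ {a K} → a + pieceWeight e * count K ≤ weight B′ →
                      a + pieceWeight e * count (K ∪ ⁅ y ⁆) ≤ weight B
      weight-extend {e} bonus {a} {K} bound = begin
        a + c * count (K ∪ ⁅ y ⁆)       ≤⟨ +-monoʳ-≤ a (*-monoʳ-≤ c (count-∪⁅⁆ K y)) ⟩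
        a + c * suc (count K)           ≡⟨ cong (a +_) (trans (*-suc c (count K)) (+-comm c _)) ⟩
        a + (c * count K + c)           ≡⟨ +-assoc a _ c ⟨
        a + c * count K + c             ≤⟨ +-mono-≤ bound (piece-weight bonus) ⟩
        weight B′ + weight (B ∩ T)      ≡⟨ trans (+-comm (weight B′) _) (sym (weight-split B T)) ⟩
        weight B                        ∎
        where
        open ≤-Reasoning
        c = pieceWeight e

      extend : ∀ {e} → Bonus B e → Pruned B′ ρ e → Pruned B ρ e
      extend bonus pruned = record
        { rest = rest ; kernel = kernel ∪ ⁅ y ⁆
        ; rest⊆B = λ w w∈rest → B′⊆B w (rest⊆B w w∈rest)
        ; rest-low = rest-low ; rest-closed = rest-closed
        ; kernel⊆B = kernel′⊆B ; kernel-covers = covers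
        ; rank0-kept = kept ; rank1-removed = removed
        ; weight-bound = weight-extend bonus {weight rest} {kernel} weight-bound }
        where
        open Pruned pruned
        kernel′⊆B : kernel ∪ ⁅ y ⁆ ⊆ᵖ B
        kernel′⊆B w w∈ with ∈∪⁻ kernel ⁅ y ⁆ w∈
        ... | inj₁ w∈kernel = B′⊆B w (kernel⊆B w w∈kernel)
        ... | inj₂ w∈⁅y⁆    = subst (_∈ᵖ B) (sym (x∈⁅y⁆⇒x≡y y w∈⁅y⁆)) y∈B
        covers : ∀ w → w ∈ᵖ B → w ∉ᵖ rest → Covers (kernel ∪ ⁅ y ⁆) w
        covers w w∈B w∉rest with ∈-or-∉ w T
        ... | inj₁ w∈T = let (j , j≤r , gʲw≡y) = T⇒covered w∈T in j , j≤r , ∈∪⁺ʳ kernel ⁅ y ⁆ gʲw≡y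
        ... | inj₂ w∉T = let (i , i≤r , gⁱw∈kernel) = kernel-covers w (∈∖⁺ B T w∈B w∉T) w∉rest in
          i , i≤r , ∈∪⁺ˡ kernel ⁅ y ⁆ gⁱw∈kernel
        kept : ∀ w → w ∈ᵖ B → ρ w ≡ 0 → w ∈ᵖ rest
        kept w w∈B ρw≡0 with ∈-or-∉ w T
        ... | inj₁ w∈T = contradiction ρw≡0 (<⇒≢ (T⇒1≤ρ w∈T) ∘ sym)
        ... | inj₂ w∉T = rank0-kept w (∈∖⁺ B T w∈B w∉T) ρw≡0
        removed : ∀ w → w ∈ᵖ B → w ∉ᵖ rest → ρ w ≡ 1 → ∃ λ x′ → x′ ∈ᵖ B × g ^[ r ] x′ ≡ w
        removed w w∈B w∉rest ρw≡1 with ∈-or-∉ w T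
        ... | inj₁ w∈T = x , x∈B , sym (T∩ρ≡1⇒y w∈T ρw≡1)
        ... | inj₂ w∉T = let (x′ , x′∈B′ , gʳx′≡w) = rank1-removed w (∈∖⁺ B T w∈B w∉T) w∉rest ρw≡1 in
          x′ , B′⊆B x′ x′∈B′ , gʳx′≡w

    abstract
      prune : ∀ {B ρ e} → RankClosed B ρ → B ⊆ᵖ isU → Bonus B e → Pruned B ρ e
      prune {B} closed B⊆U bonus = go closed B⊆U bonus (<-wellFounded (count B))
        where
        go : ∀ {B ρ e} → RankClosed B ρ → B ⊆ᵖ isU → Bonus B e → Acc _<_ (count B) → Pruned B ρ e
        go {B} {ρ} closed B⊆U bonus (acc rec) with empty-or-argmax B ρ
        ... | inj₁ empty = nothing-pruned (λ w w∈B → ⊥-elim (∈∉⇒⊥ B w∈B (empty w))) closed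
        ... | inj₂ (x , x∈B , max) with ρ x ≤? r
        ...   | yes ρx≤r = nothing-pruned (λ w w∈B → ≤-trans (max w w∈B) ρx≤r) closed
        ...   | no  ρx≰r = extend bonus (go B′-closed (λ w w∈B′ → B⊆U w (B′⊆B w w∈B′))
                                           (bonus-⊆ B′⊆B bonus) (rec smaller))
          where open Piece closed B⊆U x∈B max (≰⇒> ρx≰r)

    module Components (1≤r : 1 ≤ r)
      (long-cycles : ∀ w k → p ^[ suc k ] w ≡ w → InjectiveBelow (suc k) (λ j → p ^[ j ] w) →
                     suc (suc r) ≤ suc k) where

      ℓ : ℕ
      ℓ = suc (suc r)

      record SmallKernel (A : Pred n) : Set where
        field
          Q       : Pred n
          Q⊆U     : Q ⊆ᵖ isU
          covers  : ∀ w → w ∈ᵖ A → Covers Q w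
          bound   : ℓ * count Q ≤ weight A

      small-kernel-split : ∀ A Y → SmallKernel (A ∩ Y) → SmallKernel (A ∖ Y) → SmallKernel A
      small-kernel-split A Y K₁ K₂ = record
        { Q = K₁.Q ∪ K₂.Q
        ; Q⊆U = Q⊆U
        ; covers = covers
        ; bound = begin
            ℓ * count (K₁.Q ∪ K₂.Q)           ≤⟨ *-monoʳ-≤ ℓ (count-∪ K₁.Q K₂.Q) ⟩
            ℓ * (count K₁.Q + count K₂.Q)     ≡⟨ *-distribˡ-+ ℓ (count K₁.Q) (count K₂.Q) ⟩
            ℓ * count K₁.Q + ℓ * count K₂.Q   ≤⟨ +-mono-≤ K₁.bound K₂.bound ⟩
            weight (A ∩ Y) + weight (A ∖ Y)   ≡⟨ weight-split A Y ⟨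
            weight A                          ∎ }
        where
        module K₁ = SmallKernel K₁
        module K₂ = SmallKernel K₂
        open ≤-Reasoning
        Q⊆U : K₁.Q ∪ K₂.Q ⊆ᵖ isU
        Q⊆U w w∈Q with ∈∪⁻ K₁.Q K₂.Q w∈Q
        ... | inj₁ w∈Q₁ = K₁.Q⊆U w w∈Q₁
        ... | inj₂ w∈Q₂ = K₂.Q⊆U w w∈Q₂
        covers : ∀ w → w ∈ᵖ A → Covers (K₁.Q ∪ K₂.Q) w
        covers w w∈A with ∈-or-∉ w Y
        ... | inj₁ w∈Y = let (i , i≤r , gⁱw∈Q₁) = K₁.covers w (∈∩⁺ A Y w∈A w∈Y) in
          i , i≤r , ∈∪⁺ˡ K₁.Q K₂.Q gⁱw∈Q₁
        ... | inj₂ w∉Y = let (i , i≤r , gⁱw∈Q₂) = K₂.covers w (∈∖⁺ A Y w∈A w∉Y) in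
          i , i≤r , ∈∪⁺ʳ K₁.Q K₂.Q gⁱw∈Q₂

      -- How the component of z is attached: through a tree vertex w₁ of height 1 hanging at z, or
      -- (when every vertex is cyclic) not at all, in which case every vertex has a V-neighbour.
      data Anchor (A : Pred n) (z : Fin n) : ℕ → Set where
        tree-root  : ∀ {w₁} → w₁ ∈ᵖ A → g w₁ ≡ z → height w₁ ≡ 1 → Anchor A z 0
        all-cyclic : (∀ w → w ∈ᵖ A → Cyclic w) → Anchor A z 1

      module Component {A} (A⊆U : A ⊆ᵖ isU) (A-closed : ∀ w → w ∈ᵖ A → g w ∈ᵖ A)
                       (A-low : ∀ w → w ∈ᵖ A → height w ≤ r)
                       {z} (z∈A : z ∈ᵖ A) (z-cyc : Cyclic z) where

        reaches-z? : ∀ w → Dec (Reaches w z)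
        reaches-z? w = reaches? w z

        R : Pred n
        R = ⟦ reaches-z? ⟧

        K : Pred n
        K = A ∩ R

        A∖R-closed : ∀ w → w ∈ᵖ A ∖ R → g w ∈ᵖ A ∖ R
        A∖R-closed w w∈A∖R with ∈∖⁻ A R w∈A∖R
        ... | w∈A , w∉R = ∈∖⁺ A R (A-closed w w∈A) gw∉R
          where
          gw∉R : g w ∉ᵖ R
          gw∉R with ∈-or-∉ (g w) R
          ... | inj₂ gw∉R = gw∉R
          ... | inj₁ gw∈R = let (i , _ , hit) = ∈⟦⟧⁻ reaches-z? gw∈R in
            ⊥-elim (∈∉⇒⊥ R (∈⟦⟧⁺ reaches-z? (reaches (suc i) (trans (sym (^-comm g i w)) hit))) w∉R)

        K⊆U : K ⊆ᵖ isU
        K⊆U w w∈K = A⊆U w (proj₁ (∈∩⁻ A R w∈K))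

        K-closed : ∀ w → w ∈ᵖ K → g w ∈ᵖ K
        K-closed w w∈K with ∈∩⁻ A R w∈K
        ... | w∈A , w∈R = ∈∩⁺ A R (A-closed w w∈A) (∈⟦⟧⁺ reaches-z? (reaches-g z-cyc (∈⟦⟧⁻ reaches-z? w∈R)))

        z∈K : z ∈ᵖ K
        z∈K = ∈∩⁺ A R z∈A (∈⟦⟧⁺ reaches-z? (reaches 0 refl))

        module Dist = HittingTime (_≡ z) (_≟ z)

        ρ : Fin n → ℕ
        ρ = Dist.time

        K-hits : ∀ w → w ∈ᵖ K → ∃ λ i → i ≤ n × g ^[ i ] w ≡ z
        K-hits w w∈K = let (i , i<n , hit) = ∈⟦⟧⁻ reaches-z? (proj₂ (∈∩⁻ A R w∈K)) in i , <⇒≤ i<n , hit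

        K-rankClosed : RankClosed K ρ
        K-rankClosed = Dist.time-rankClosed K K-hits (λ w w∈K _ → K-closed w w∈K)

        bonus : ∀ {e} → Anchor A z e → Bonus K e
        bonus (tree-root _ _ _) = no-bonus
        bonus (all-cyclic cyc)  = V-preds λ w w∈K → cyclic-V-pred (cyc w (proj₁ (∈∩⁻ A R w∈K))) (K⊆U w w∈K)

        pruned : ∀ {e} → Anchor A z e → Pruned K ρ e
        pruned anchor = prune K-rankClosed K⊆U (bonus anchor)

        orbit-weight : ℓ ≤ weight K
        orbit-weight with least (λ i → p ^[ i ] (p z) ≟ z) (proj₁ p-return) (proj₂ p-return)
          where p-return = cyclic⇒p-return z-cyc
        ... | j , _ , hitʲ , early = begin
          ℓ         ≤⟨ long-cycles (p z) j (cong p hitʲ) orbit-injective ⟩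
          suc j     ≤⟨ injectiveBelow⇒≤count (K ⁺) (λ i → p ^[ i ] (p z)) (suc j) orbit-injective
                         (λ {i} _ → subst (_∈ᵖ K ⁺) (sym (^-comm p i z)) (orbit∈K⁺ (suc i))) ⟩
          weight K  ∎
          where
          open ≤-Reasoning
          orbit-injective : InjectiveBelow (suc j) (λ i → p ^[ i ] (p z))
          orbit-injective = firstHit-injective p hitʲ early
          orbit∈K⁺ : ∀ i → p ^[ i ] z ∈ᵖ K ⁺
          orbit∈K⁺ zero    = U∈⁺ {K} (K⊆U z z∈K) z∈K
          orbit∈K⁺ (suc i) = ⁺-p-closed K⊆U K-closed _ (orbit∈K⁺ i)

        ρz≡0 : ρ z ≡ 0
        ρz≡0 = Dist.time-zero refl

        rest-weight : ∀ {e} (anchor : Anchor A z e) → 3 ∸ e ≤ weight (Pruned.rest (pruned anchor))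
        rest-weight anchor@(tree-root {w₁} w₁∈A gw₁≡z hw₁≡1) =
          weight-lower rest 2 1 u (λ _ → p w₁) (injectiveBelow-2 u z≢w₁) u∈rest
                       (injectiveBelow-1 _) (below-1 (p-of-U w₁∈U , subst (_∈ᵖ rest) (sym gw₁≡z) z∈rest))
          where
          open Pruned (pruned anchor)
          z∈rest = rank0-kept z z∈K ρz≡0
          w₁∈U = A⊆U w₁ w₁∈A
          z≢w₁ : z ≢ w₁
          z≢w₁ z≡w₁ = 0≢1+n (trans (sym (cyclic⇒height≡0 z-cyc)) (trans (cong height z≡w₁) hw₁≡1))
          w₁∈K : w₁ ∈ᵖ K
          w₁∈K = ∈∩⁺ A R w₁∈A (∈⟦⟧⁺ reaches-z? (reaches 1 gw₁≡z))
          ρw₁≡1 : ρ w₁ ≡ 1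
          ρw₁≡1 = let (_ , i≤n , hit) = K-hits w₁ w₁∈K in
            Dist.time≡ i≤n hit (gw₁≡z , λ { zero _ → z≢w₁ ∘ sym ; (suc _) (s≤s ()) })
          -- A removed w₁ would lie r steps above a vertex of height r + 1.
          w₁∈rest : w₁ ∈ᵖ rest
          w₁∈rest with ∈-or-∉ w₁ rest
          ... | inj₁ w₁∈rest = w₁∈rest
          ... | inj₂ w₁∉rest with rank1-removed w₁ w₁∈K w₁∉rest ρw₁≡1
          ...   | x , x∈K , gʳx≡w₁ = contradiction (A-low x (proj₁ (∈∩⁻ A R x∈K))) (<⇒≱ (begin-strict
            r                        <⟨ n<1+n r ⟩
            1 + r                    ≡⟨ cong (_+ r) (trans (cong height gʳx≡w₁) hw₁≡1) ⟨
            height (g ^[ r ] x) + r  ≡⟨ height-g^ r x (subst (1 ≤_) (sym (trans (cong height gʳx≡w₁) hw₁≡1)) ≤-refl) ⟩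
            height x                 ∎))
            where open ≤-Reasoning
          u : ℕ → Fin n
          u zero    = z
          u (suc _) = w₁
          u∈rest : ∀ {i} → i < 2 → u i ∈ᵖ rest × u i ∈ᵖ isU
          u∈rest {zero}  _ = z∈rest , K⊆U z z∈K
          u∈rest {suc _} _ = w₁∈rest , w₁∈U
        rest-weight anchor@(all-cyclic cyc) with cyclic-V-pred z-cyc (K⊆U z z∈K)
        ... | v , v∉U , pv≡z =
          weight-lower rest 1 1 (λ _ → z) (λ _ → v) (injectiveBelow-1 _) (below-1 (z∈rest , K⊆U z z∈K))
                       (injectiveBelow-1 _) (below-1 (v∉U , subst (_∈ᵖ rest) (sym pv≡z) z∈rest))
          where
          open Pruned (pruned anchor)
          z∈rest = rank0-kept z z∈K ρz≡0

        component-kernel : ∀ {e} → Anchor A z e → SmallKernel K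
        component-kernel {e} anchor = record
          { Q = kernel ∪ ⁅ z ⁆ ; Q⊆U = λ w w∈Q → K⊆U w (Q⊆K w w∈Q) ; covers = covers ; bound = bound }
          where
          open Pruned (pruned anchor)
          Q⊆K : kernel ∪ ⁅ z ⁆ ⊆ᵖ K
          Q⊆K w w∈Q with ∈∪⁻ kernel ⁅ z ⁆ w∈Q
          ... | inj₁ w∈kernel = kernel⊆B w w∈kernel
          ... | inj₂ w∈⁅z⁆    = subst (_∈ᵖ K) (sym (x∈⁅y⁆⇒x≡y z w∈⁅z⁆)) z∈K
          covers : ∀ w → w ∈ᵖ K → Covers (kernel ∪ ⁅ z ⁆) w
          covers w w∈K with ∈-or-∉ w rest
          ... | inj₁ w∈rest = let (_ , i≤n , hit) = K-hits w w∈K in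
            ρ w , rest-low w w∈rest ,
            ∈∪⁺ʳ kernel ⁅ z ⁆ (subst (_∈ᵖ ⁅ z ⁆) (sym (proj₁ (Dist.time-least i≤n hit))) (x∈⁅x⁆ z))
          ... | inj₂ w∉rest = let (i , i≤r , gⁱw∈kernel) = kernel-covers w w∈K w∉rest in
            i , i≤r , ∈∪⁺ˡ kernel ⁅ z ⁆ gⁱw∈kernel
          arith : ∀ {e} → Anchor A z e → ∀ s → ℓ * suc (suc s) ≤ 3 ∸ e + pieceWeight e * suc s
          arith (tree-root _ _ _) s = kernel-arith-tree r s 1≤r
          arith (all-cyclic _)    s = kernel-arith-cyclic r s
          bound : ℓ * count (kernel ∪ ⁅ z ⁆) ≤ weight K
          bound with count kernel | count-∪⁅⁆ kernel z | weight-bound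
          ... | zero  | count-Q≤1 | _ = begin
            ℓ * count (kernel ∪ ⁅ z ⁆)  ≤⟨ *-monoʳ-≤ ℓ count-Q≤1 ⟩
            ℓ * 1                       ≡⟨ *-identityʳ ℓ ⟩
            ℓ                           ≤⟨ orbit-weight ⟩
            weight K                    ∎
            where open ≤-Reasoning
          ... | suc s | count-Q≤ | pruned-bound = begin
            ℓ * count (kernel ∪ ⁅ z ⁆)             ≤⟨ *-monoʳ-≤ ℓ count-Q≤ ⟩
            ℓ * suc (suc s)                        ≤⟨ arith anchor s ⟩
            3 ∸ e + pieceWeight e * suc s          ≤⟨ +-monoˡ-≤ _ (rest-weight anchor) ⟩
            weight rest + pieceWeight e * suc s    ≤⟨ pruned-bound ⟩
            weight K                               ∎
            where open ≤-Reasoning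

      no-kernel : ∀ {A} → (∀ w → w ∉ᵖ A) → SmallKernel A
      no-kernel {A} empty = record
        { Q = ∅ ; Q⊆U = λ _ () ; covers = λ w w∈A → ⊥-elim (∈∉⇒⊥ A w∈A (empty w))
        ; bound = ≤-trans (≤-reflexive (trans (cong (ℓ *_) (count-∅ {n})) (*-zeroʳ ℓ))) z≤n }

      small-kernel-low : ∀ {A} → A ⊆ᵖ isU → (∀ w → w ∈ᵖ A → g w ∈ᵖ A) →
                         (∀ w → w ∈ᵖ A → height w ≤ r) → SmallKernel A
      small-kernel-low {A} A⊆U A-closed A-low = go A⊆U A-closed A-low (<-wellFounded (count A))
        where
        go : ∀ {A} → A ⊆ᵖ isU → (∀ w → w ∈ᵖ A → g w ∈ᵖ A) → (∀ w → w ∈ᵖ A → height w ≤ r) →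
             Acc _<_ (count A) → SmallKernel A
        go {A} A⊆U A-closed A-low (acc rec) = choose (empty-or-element A) (empty-or-element (A ∖ C))
          where
          C = ⟦ cyclic? ⟧
          split : ∀ {z e} → z ∈ᵖ A → Cyclic z → Anchor A z e → SmallKernel A
          split z∈A z-cyc anchor = small-kernel-split A R (component-kernel anchor)
            (go (λ w w∈ → A⊆U w (proj₁ (∈∖⁻ A R w∈))) A∖R-closed (λ w w∈ → A-low w (proj₁ (∈∖⁻ A R w∈)))
                (rec (count-∖-< A R z∈K)))
            where open Component A⊆U A-closed A-low z∈A z-cyc
          choose : (∀ w → w ∉ᵖ A) ⊎ ∃ (_∈ᵖ A) → (∀ w → w ∉ᵖ A ∖ C) ⊎ ∃ (_∈ᵖ A ∖ C) → SmallKernel A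
          choose (inj₁ empty) _ = no-kernel empty
          choose (inj₂ (a , a∈A)) (inj₁ none-acyclic) = split a∈A (all-cyc a a∈A) (all-cyclic all-cyc)
            where
            all-cyc : ∀ w → w ∈ᵖ A → Cyclic w
            all-cyc w w∈A with cyclic? w in cyc?
            ... | yes w-cyc = w-cyc
            ... | no  _     = ⊥-elim (∈∉⇒⊥ (A ∖ C) (∈∖⁺ A C w∈A (cong does cyc?)) (none-acyclic w))
          choose _ (inj₂ (w , w∈A∖C)) with ∈∖⁻ A C w∈A∖C
          ... | w∈A , w∉C with tree-bottom A-closed w∈A (λ w-cyc → ∈∉⇒⊥ C (∈⟦⟧⁺ cyclic? w-cyc) w∉C)
          ...   | w₁ , w₁∈A , hw₁≡1 , z-cyc = split (A-closed w₁ w₁∈A) z-cyc (tree-root w₁∈A refl hw₁≡1)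

      small-kernel-U : SmallKernel isU
      small-kernel-U =
        small-kernel-split isU rest (small-kernel-low U∩rest⊆U U∩rest-closed U∩rest-low) removed-kernel
        where
        open Pruned (prune (height-rankClosed isU λ w w∈U → trans (isU-g w) w∈U) (λ _ w∈U → w∈U) no-bonus)
        U∩rest⊆U : isU ∩ rest ⊆ᵖ isU
        U∩rest⊆U w w∈ = proj₁ (∈∩⁻ isU rest w∈)
        U∩rest-low : ∀ w → w ∈ᵖ isU ∩ rest → height w ≤ r
        U∩rest-low w w∈ = rest-low w (proj₂ (∈∩⁻ isU rest w∈))
        U∩rest-closed : ∀ w → w ∈ᵖ isU ∩ rest → g w ∈ᵖ isU ∩ rest
        U∩rest-closed w w∈ = ∈∩⁺ isU rest gw∈U (gw∈rest (height w ℕ≟ 0))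
          where
          gw∈U : g w ∈ᵖ isU
          gw∈U = trans (isU-g w) (proj₁ (∈∩⁻ isU rest w∈))
          gw∈rest : Dec (height w ≡ 0) → g w ∈ᵖ rest
          gw∈rest (yes hw≡0) = rank0-kept (g w) gw∈U (cyclic⇒height≡0 (cyclic-g (height≡0⇒cyclic hw≡0)))
          gw∈rest (no  hw≢0) = proj₁ (rest-closed w (proj₂ (∈∩⁻ isU rest w∈)) (n≢0⇒n>0 hw≢0))
        removed-kernel : SmallKernel (isU ∖ rest)
        removed-kernel = record
          { Q = kernel ; Q⊆U = kernel⊆B
          ; covers = λ w w∈ → kernel-covers w (proj₁ (∈∖⁻ isU rest w∈)) (proj₂ (∈∖⁻ isU rest w∈))
          ; bound = ≤-trans (*-monoˡ-≤ (count kernel) ℓ≤pieceWeight)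
                            (+-cancelˡ-≤ (weight rest) _ _ (begin
              weight rest + pieceWeight 0 * count kernel    ≤⟨ weight-bound ⟩
              weight isU                                    ≡⟨ weight-split isU rest ⟩
              weight (isU ∩ rest) + weight (isU ∖ rest)
                ≡⟨ cong (_+ weight (isU ∖ rest)) (weight-∩-⊆ isU rest rest⊆B) ⟩
              weight rest + weight (isU ∖ rest)             ∎)) }
          where
          open ≤-Reasoning
          ℓ≤pieceWeight : ℓ ≤ pieceWeight 0
          ℓ≤pieceWeight = ≤-trans (s≤s (+-monoˡ-≤ r 1≤r)) (≤-reflexive (sym (+-identityʳ _)))

module InNeighbours (D : Digraph) (source-free : SourceFree D) where

  pred : Fin (n D) → Fin (n D)
  pred v = proj₁ (source-free v)

  pred-arc : ∀ v → Arc D (pred v) v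
  pred-arc v = proj₂ (source-free v)

  walk : ∀ k w → Walk D (pred ^[ k ] w) w k
  walk zero    w = []
  walk (suc k) w = pred-arc (pred ^[ k ] w) ∷ walk k w

  orbit-cycle : ∀ w k → pred ^[ suc k ] w ≡ w → InjectiveBelow (suc k) (λ j → pred ^[ j ] w) → Cycle D k
  orbit-cycle w k period inj = record { vtx = vtx ; inj = vtx-injective ; arcs = arcs }
    where
    vtx : Fin (suc k) → Fin (n D)
    vtx i = pred ^[ k ∸ toℕ i ] w
    vtx-injective : ∀ {i j} → vtx i ≡ vtx j → i ≡ j
    vtx-injective {i} {j} eq = Finₚ.toℕ-injective (begin
      toℕ i            ≡⟨ m∸[m∸n]≡n (Finₚ.toℕ≤pred[n] i) ⟨
      k ∸ (k ∸ toℕ i)  ≡⟨ cong (k ∸_) (inj (s≤s (m∸n≤m k (toℕ i))) (s≤s (m∸n≤m k (toℕ j))) eq) ⟩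
      k ∸ (k ∸ toℕ j)  ≡⟨ m∸[m∸n]≡n (Finₚ.toℕ≤pred[n] j) ⟩
      toℕ j            ∎)
      where open ≡-Reasoning
    toℕ-next : ∀ i → toℕ (next i) ≡ suc (toℕ i) % suc k
    toℕ-next i = Finₚ.toℕ-fromℕ< _
    vtx-step : ∀ i → vtx i ≡ pred (vtx (next i))
    vtx-step i with m≤n⇒m<n∨m≡n (Finₚ.toℕ≤pred[n] i)
    ... | inj₁ i<k = cong (λ j → pred ^[ j ] w) (begin
      k ∸ toℕ i                ≡⟨ +-∸-assoc 1 i<k ⟩
      suc (k ∸ suc (toℕ i))    ≡⟨ cong (λ j → suc (k ∸ j)) (trans (toℕ-next i) (m<n⇒m%n≡m (s≤s i<k))) ⟨
      suc (k ∸ toℕ (next i))   ∎)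
      where open ≡-Reasoning
    ... | inj₂ i≡k = begin
      pred ^[ k ∸ toℕ i ] w         ≡⟨ cong (λ j → pred ^[ k ∸ j ] w) i≡k ⟩
      pred ^[ k ∸ k ] w             ≡⟨ cong (λ j → pred ^[ j ] w) (n∸n≡0 k) ⟩
      w                             ≡⟨ period ⟨
      pred (pred ^[ k ] w)          ≡⟨ cong (λ j → pred (pred ^[ k ∸ j ] w)) next≡0 ⟨
      pred (vtx (next i))           ∎
      where
      open ≡-Reasoning
      next≡0 : toℕ (next i) ≡ 0
      next≡0 = trans (toℕ-next i) (trans (cong (λ j → suc j % suc k) i≡k) (n%n≡0 (suc k)))
    arcs : ∀ i → Arc D (vtx i) (vtx (next i))
    arcs i = subst (λ u → Arc D u (vtx (next i))) (sym (vtx-step i)) (pred-arc (vtx (next i)))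

  module _ (side : Fin (n D) → Bool) (bipartite : IsBipartition D side) where

    alternates : ∀ w → side (pred w) ≡ not (side w)
    alternates w = ¬-not (bipartite (pred w) w (pred-arc w))

    open Alternating (n D) pred side alternates

    small-kernel-in-U : ∀ r → 1 ≤ r → (∀ m → Cycle D m → 2 + r ≤ suc m) →
      ∃ λ (Q : Subset (n D)) →
        IsQKernel D (suc (r + r)) Q × (2 + r) * ∣ Q ∣ ≤ n D × (∀ v → v ∈ Q → InU D side v)
    small-kernel-in-U r 1≤r long-cycles =
      tabulate K.Q , (independent , near) , size , λ v v∈Q → K.Q⊆U v (∈tabulate⁻ K.Q v∈Q)
      where
      open Pruning r
      open Components 1≤r (λ w k period inj → long-cycles k (orbit-cycle w k period inj))
      module K = SmallKernel small-kernel-U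
      independent : Independent D (tabulate K.Q)
      independent u v u∈Q v∈Q = ¬-not λ uv → bipartite u v uv
        (trans (K.Q⊆U u (∈tabulate⁻ K.Q u∈Q)) (sym (K.Q⊆U v (∈tabulate⁻ K.Q v∈Q))))
      near : ∀ v → DistLe D (tabulate K.Q) v (suc (r + r))
      near v = by-side (∈-or-∉ v side)
        where
        by-side : v ∈ᵖ side ⊎ v ∉ᵖ side → DistLe D (tabulate K.Q) v (suc (r + r))
        by-side (inj₁ v∈U) = let (i , i≤r , gⁱv∈Q) = K.covers v v∈U in
          pred ^[ i + i ] v , i + i , ∈tabulate⁺ K.Q (subst (_∈ᵖ K.Q) (g^≡p^ i v) gⁱv∈Q) ,
          m≤n⇒m≤1+n (+-mono-≤ i≤r i≤r) , walk (i + i) v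
        by-side (inj₂ v∉U) =
          let (i , i≤r , gⁱpv∈Q) = K.covers (pred v) (trans (alternates v) (cong not v∉U)) in
          pred ^[ suc (i + i) ] v , suc (i + i) ,
          ∈tabulate⁺ K.Q (subst (_∈ᵖ K.Q) (trans (g^≡p^ i (pred v)) (^-comm pred (i + i) v)) gⁱpv∈Q) ,
          s≤s (+-mono-≤ i≤r i≤r) , walk (suc (i + i)) v
      size : (2 + r) * ∣ tabulate K.Q ∣ ≤ n D
      size = begin
        (2 + r) * ∣ tabulate K.Q ∣   ≡⟨ cong ((2 + r) *_) (∣tabulate∣≡count K.Q) ⟩
        (2 + r) * count K.Q          ≤⟨ K.bound ⟩
        weight side                  ≡⟨ weight-isU ⟩
        n D                          ∎
        where open ≤-Reasoning

qKernel-mono : ∀ {D Q q q′} → q ≤ q′ → IsQKernel D q Q → IsQKernel D q′ Q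
qKernel-mono q≤q′ (independent , near) =
  independent , λ v → let (u , k , u∈Q , k≤q , walk) = near v in u , k , u∈Q , ≤-trans k≤q q≤q′ , walk

theorem2p7 : (D : Digraph) → (side : Fin (n D) → Bool) →
    SourceFree D → IsBipartition D side →
    (q ℓ : ℕ) → 3 ≤ q → 3 ≤ ℓ → 2 * ℓ ≤ q + 3 →
    (∀ m → Cycle D m → ℓ ≤ suc m) →
    ∃ λ (Q : Subset (n D)) →
      IsQKernel D q Q × ℓ * ∣ Q ∣ ≤ n D × (∀ v → v ∈ Q → InU D side v)
theorem2p7 D side source-free bipartite q (suc (suc (suc r))) _ (s≤s (s≤s (s≤s _))) 2ℓ≤q+3 long-cycles =
  let (Q , kernel , size , Q⊆U) =
        InNeighbours.small-kernel-in-U D source-free side bipartite (suc r) (s≤s z≤n) long-cycles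
  in Q , qKernel-mono radius≤q kernel , size , Q⊆U
  where
  radius≤q : suc (suc r + suc r) ≤ q
  radius≤q = +-cancelʳ-≤ 3 _ q (≤-trans (≤-reflexive (identity r)) 2ℓ≤q+3)
    where
    identity : ∀ r → suc (suc r + suc r) + 3 ≡ 2 * suc (suc (suc r))
    identity = solve-∀
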